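{- Let $S\neq0$ be a commutative ring with a conjugation, and let $\mathscr{S}_2$ be the set of $|\psi\rangle\in\mathscr{D}$ with $\langle\psi|\psi\rangle=1_S$. Then $\mathscr{S}_2$ is a state space.
   Context: A conjugation on $S$ is a ring automorphism $s\mapsto\bar s$ with $\bar{\bar s}=s$. $\mathcal{B}=S^{\{0,1\}}$, $\mathscr{D}=S\oplus\mathcal{B}\oplus\mathcal{B}^{\otimes2}\oplus\cdots$ with $\mathcal{B}^{\otimes n}\cong S^{\{0,1\}^n}$ having standard basis $|x\rangle$, $x\in\{0,1\}^n$; $\vec0$ is the zero vector; $\otimes$ is the tensor (Kronecker) product; $\langle\phi|\psi\rangle=\sum_x\bar\phi_x\psi_x$. A state space is a subset $\mathscr{S}\subseteq\mathscr{D}$ such that (1) for $|\psi\rangle\in\mathscr{S}$ and $|\phi\rangle\in\mathscr{D}$, $|\phi\rangle\otimes|\psi\rangle\in\mathscr{S}$ iff $|\phi\rangle\in\mathscr{S}$, and $|\psi\rangle\otimes|\phi\rangle\in\mathscr{S}$ iff $|\phi\rangle\in\mathscr{S}$; (2) $\mathscr{S}$ contains $|x\rangle$ for every $x\in\{0,1\}^*$ and does not contain $\vec0$. -}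

module Defs where

open import Level using (Level; _⊔_; suc)
open import Algebra.Bundles using (CommutativeRing)
open import Algebra.Morphism.Structures using (module RingMorphisms)
open import Data.Bool using (Bool; true; false; if_then_else_)
import Data.Bool.Properties as BoolP
open import Data.Nat using (ℕ; zero) renaming (suc to sucℕ; _+_ to _+ℕ_)
open import Data.Vec using (Vec; []; _∷_; take; drop)
open import Data.Vec.Properties using (≡-dec)
open import Data.Product using (Σ; _,_; _×_)
open import Relation.Nullary using (¬_; does)
open import Relation.Unary using (Pred; _∈_; _∉_)

module _ {c ℓ : Level} (R : CommutativeRing c ℓ) where
  open CommutativeRing R renaming (Carrier to S)

  record Conjugation : Set (c ⊔ ℓ) where
    field
      conj          : S → S
      isAutomorphism : RingMorphisms.IsRingIsomorphism rawRing rawRing conj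
      involutive    : ∀ s → conj (conj s) ≈ s

  -- B^{⊗n} ≅ S^{{0,1}^n}: vectors indexed by bit strings of length n.
  Ket : ℕ → Set c
  Ket n = Vec Bool n → S

  𝒟 : Set c
  𝒟 = Σ ℕ Ket

  basis : ∀ {n} → Vec Bool n → 𝒟
  basis {n} x = n , λ y → if does (≡-dec BoolP._≟_ x y) then 1# else 0#

  zeroVec : ℕ → 𝒟
  zeroVec n = n , λ _ → 0#

  _⊗_ : 𝒟 → 𝒟 → 𝒟
  (m , φ) ⊗ (n , ψ) = m +ℕ n , λ z → φ (take m z) * ψ (drop m z)

  sumBits : ∀ n → (Vec Bool n → S) → S
  sumBits zero f = f []
  sumBits (sucℕ n) f = sumBits n (λ x → f (false ∷ x)) + sumBits n (λ x → f (true ∷ x))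

  record IsStateSpace {p : Level} (𝒮 : Pred 𝒟 p) : Set (c ⊔ p) where
    field
      tensorˡ  : ∀ (ψ φ : 𝒟) → ψ ∈ 𝒮 → ((φ ⊗ ψ) ∈ 𝒮 → φ ∈ 𝒮) × (φ ∈ 𝒮 → (φ ⊗ ψ) ∈ 𝒮)
      tensorʳ  : ∀ (ψ φ : 𝒟) → ψ ∈ 𝒮 → ((ψ ⊗ φ) ∈ 𝒮 → φ ∈ 𝒮) × (φ ∈ 𝒮 → (ψ ⊗ φ) ∈ 𝒮)
      hasBasis : ∀ n (x : Vec Bool n) → basis x ∈ 𝒮
      noZero   : ∀ n → zeroVec n ∉ 𝒮

  module _ (C : Conjugation) where
    open Conjugation C

    ⟨_∣_⟩ : ∀ {n} → Ket n → Ket n → S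
    ⟨_∣_⟩ {n} φ ψ = sumBits n (λ x → conj (φ x) * ψ x)

    𝒮₂ : Pred 𝒟 ℓ
    𝒮₂ (n , ψ) = ⟨ ψ ∣ ψ ⟩ ≈ 1#

{-# OPTIONS --safe #-}

-- The squared norm ⟨ψ|ψ⟩ is multiplicative under ⊗: splitting a bit string into
-- its prefix and suffix turns the sum over {0,1}^(m+n) into a double sum, and the
-- conjugation is multiplicative. So once ψ has norm 1, φ ⊗ ψ and ψ ⊗ φ have the
-- same norm as φ. Basis vectors have norm 1 since conj 1 = 1, and the zero vector
-- has norm 0, which differs from 1 because S ≠ 0.
module Submission where

open import Defs hiding (_⊗_; ⟨_∣_⟩)
open import Level using (Level)
open import Algebra.Bundles using (CommutativeRing)
open import Algebra.Morphism.Structures using (module RingMorphisms)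
open import Data.Bool using (Bool; true; false; if_then_else_)
import Data.Bool.Properties as BoolP
open import Data.Nat using (zero) renaming (suc to sucℕ; _+_ to _+ℕ_)
open import Data.Vec using (Vec; []; _∷_; take; drop)
open import Data.Vec.Properties using (≡-dec)
open import Data.Product using (_,_; proj₂)
open import Relation.Nullary using (¬_; does)
open import Relation.Unary using (_∈_)
import Algebra.Properties.CommutativeSemigroup as CommutativeSemigroupProperties
import Relation.Binary.Reasoning.Setoid as SetoidReasoning

module BitSums {c ℓ : Level} (R : CommutativeRing c ℓ) where
  open CommutativeRing R renaming (Carrier to S)
  open SetoidReasoning setoid

  sumBits-cong : ∀ n {f g : Vec Bool n → S} → (∀ x → f x ≈ g x) → sumBits R n f ≈ sumBits R n g
  sumBits-cong zero f≈g = f≈g []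
  sumBits-cong (sucℕ n) f≈g =
    +-cong (sumBits-cong n (λ x → f≈g (false ∷ x))) (sumBits-cong n (λ x → f≈g (true ∷ x)))

  sumBits-zero : ∀ n → sumBits R n (λ _ → 0#) ≈ 0#
  sumBits-zero zero = refl
  sumBits-zero (sucℕ n) = trans (+-cong (sumBits-zero n) (sumBits-zero n)) (+-identityˡ 0#)

  sumBits-take-drop : ∀ m n (f : Vec Bool m → Vec Bool n → S) →
    sumBits R (m +ℕ n) (λ z → f (take m z) (drop m z)) ≈ sumBits R m (λ x → sumBits R n (f x))
  sumBits-take-drop zero n f = refl
  sumBits-take-drop (sucℕ m) n f =
    +-cong (sumBits-take-drop m n (λ x → f (false ∷ x))) (sumBits-take-drop m n (λ x → f (true ∷ x)))

  *-distribˡ-sumBits : ∀ n a (f : Vec Bool n → S) → a * sumBits R n f ≈ sumBits R n (λ x → a * f x)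
  *-distribˡ-sumBits zero a f = refl
  *-distribˡ-sumBits (sucℕ n) a f = begin
    a * (sumBits R n (λ x → f (false ∷ x)) + sumBits R n (λ x → f (true ∷ x)))
      ≈⟨ distribˡ a _ _ ⟩
    a * sumBits R n (λ x → f (false ∷ x)) + a * sumBits R n (λ x → f (true ∷ x))
      ≈⟨ +-cong (*-distribˡ-sumBits n a _) (*-distribˡ-sumBits n a _) ⟩
    sumBits R (sucℕ n) (λ x → a * f x) ∎

  *-distribʳ-sumBits : ∀ n a (f : Vec Bool n → S) → sumBits R n f * a ≈ sumBits R n (λ x → f x * a)
  *-distribʳ-sumBits n a f = begin
    sumBits R n f * a            ≈⟨ *-comm _ a ⟩
    a * sumBits R n f            ≈⟨ *-distribˡ-sumBits n a f ⟩
    sumBits R n (λ x → a * f x)  ≈⟨ sumBits-cong n (λ x → *-comm a (f x)) ⟩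
    sumBits R n (λ x → f x * a)  ∎

  δ : ∀ {n} → Vec Bool n → Vec Bool n → S
  δ x y = if does (≡-dec BoolP._≟_ x y) then 1# else 0#

  sumBits-δ : ∀ n (x : Vec Bool n) → sumBits R n (δ x) ≈ 1#
  sumBits-δ zero [] = refl
  sumBits-δ (sucℕ n) (false ∷ x) = trans (+-cong (sumBits-δ n x) (sumBits-zero n)) (+-identityʳ 1#)
  sumBits-δ (sucℕ n) (true ∷ x) = trans (+-cong (sumBits-zero n) (sumBits-δ n x)) (+-identityˡ 1#)

module InnerProduct {c ℓ : Level} (R : CommutativeRing c ℓ) (C : Conjugation R) where
  open CommutativeRing R renaming (Carrier to S)
  open Conjugation C
  open RingMorphisms.IsRingIsomorphism isAutomorphism using (*-homo; 1#-homo)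
  open CommutativeSemigroupProperties *-commutativeSemigroup using (interchange)
  open SetoidReasoning setoid
  open BitSums R

  ⟨_∣_⟩ : ∀ {n} → Ket R n → Ket R n → S
  ⟨_∣_⟩ = Defs.⟨_∣_⟩ R C

  _⊗_ : 𝒟 R → 𝒟 R → 𝒟 R
  _⊗_ = Defs._⊗_ R

  ⟨⊗∣⊗⟩ : ∀ {m n} (φ ψ : Ket R m) (φ′ ψ′ : Ket R n) →
    ⟨ proj₂ ((m , φ) ⊗ (n , φ′)) ∣ proj₂ ((m , ψ) ⊗ (n , ψ′)) ⟩
      ≈ ⟨ φ ∣ ψ ⟩ * ⟨ φ′ ∣ ψ′ ⟩
  ⟨⊗∣⊗⟩ {m} {n} φ ψ φ′ ψ′ = begin
    sumBits R (m +ℕ n) (λ z → conj (φ (take m z) * φ′ (drop m z)) * (ψ (take m z) * ψ′ (drop m z)))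
      ≈⟨ sumBits-cong (m +ℕ n) (λ z → trans (*-congʳ (*-homo _ _)) (interchange _ _ _ _)) ⟩
    sumBits R (m +ℕ n) (λ z → term (take m z) (drop m z))
      ≈⟨ sumBits-take-drop m n term ⟩
    sumBits R m (λ x → sumBits R n (term x))
      ≈⟨ sumBits-cong m (λ x → sym (*-distribˡ-sumBits n _ _)) ⟩
    sumBits R m (λ x → (conj (φ x) * ψ x) * ⟨ φ′ ∣ ψ′ ⟩)
      ≈⟨ sym (*-distribʳ-sumBits m _ _) ⟩
    ⟨ φ ∣ ψ ⟩ * ⟨ φ′ ∣ ψ′ ⟩ ∎
    where
    term : Vec Bool m → Vec Bool n → S
    term x y = (conj (φ x) * ψ x) * (conj (φ′ y) * ψ′ y)

  norm² : 𝒟 R → S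
  norm² (_ , ψ) = ⟨ ψ ∣ ψ ⟩

  norm²-⊗ : ∀ φ ψ → norm² (φ ⊗ ψ) ≈ norm² φ * norm² ψ
  norm²-⊗ (_ , φ) (_ , ψ) = ⟨⊗∣⊗⟩ φ φ ψ ψ

  norm²-⊗-unitʳ : ∀ φ ψ → ψ ∈ 𝒮₂ R C → norm² (φ ⊗ ψ) ≈ norm² φ
  norm²-⊗-unitʳ φ ψ ψ∈𝒮₂ = trans (norm²-⊗ φ ψ) (trans (*-congˡ ψ∈𝒮₂) (*-identityʳ _))

  norm²-⊗-unitˡ : ∀ ψ φ → ψ ∈ 𝒮₂ R C → norm² (ψ ⊗ φ) ≈ norm² φ
  norm²-⊗-unitˡ ψ φ ψ∈𝒮₂ = trans (norm²-⊗ ψ φ) (trans (*-congʳ ψ∈𝒮₂) (*-identityˡ _))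

  conj-δ*δ : ∀ {n} (x y : Vec Bool n) → conj (δ x y) * δ x y ≈ δ x y
  conj-δ*δ x y with does (≡-dec BoolP._≟_ x y)
  ... | true  = trans (*-identityʳ _) 1#-homo
  ... | false = zeroʳ _

  norm²-basis : ∀ n (x : Vec Bool n) → norm² (basis R x) ≈ 1#
  norm²-basis n x = trans (sumBits-cong n (conj-δ*δ x)) (sumBits-δ n x)

  norm²-zeroVec : ∀ n → norm² (zeroVec R n) ≈ 0#
  norm²-zeroVec n = trans (sumBits-cong n (λ _ → zeroʳ _)) (sumBits-zero n)

mainTheorem11 : {c ℓ : Level} (R : CommutativeRing c ℓ) →
    ¬ (CommutativeRing._≈_ R (CommutativeRing.1# R) (CommutativeRing.0# R)) →
    (C : Conjugation R) →
    IsStateSpace R (𝒮₂ R C)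
mainTheorem11 R 1≉0 C = record
  { tensorˡ  = λ ψ φ ψ∈𝒮₂ → let eq = norm²-⊗-unitʳ φ ψ ψ∈𝒮₂ in trans (sym eq) , trans eq
  ; tensorʳ  = λ ψ φ ψ∈𝒮₂ → let eq = norm²-⊗-unitˡ ψ φ ψ∈𝒮₂ in trans (sym eq) , trans eq
  ; hasBasis = norm²-basis
  ; noZero   = λ n zero∈𝒮₂ → 1≉0 (trans (sym zero∈𝒮₂) (norm²-zeroVec n))
  }
  where
  open CommutativeRing R using (sym; trans)
  open InnerProduct R C
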